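{- Let $\beta$ be a base formula of the form $\exists u_1,\dots,u_p,u_{p+1},\dots,u_{p+q}.\ \beta_0$, where $u_{p+1},\dots,u_{p+q}$ are the parameter variables of $\beta$ and $\beta_0$ is quantifier-free. Let $S_{p+1},\dots,S_{p+q}$ be infinite sets of ground terms. Then there exists a valuation $\sigma$ (assigning ground terms to all variables of $\beta_0$) such that $\beta_0$ is true under $\sigma$ and $\sigma(u_i)\in S_i$ for all $p+1\le i\le p+q$.
   Context: Fix a finite signature $\Sigma$ of function symbols with arities, containing at least one constant and at least one symbol of positive arity; terms are interpreted in the term algebra of finite ground $\Sigma$-terms (each symbol interpreted freely). A base formula with free variables $x_1,\dots,x_m$, internal non-parameter variables $u_1,\dots,u_p$ and internal parameter variables $u_{p+1},\dots,u_{p+q}$ (with $n=p+q$) is a formula $\exists u_1,\dots,u_n.\ \bigwedge_{1\le i<j\le n}u_i\neq u_j\ \wedge\ \bigwedge_{i=1}^p u_i=f_i(u_{l_{i,1}},\dots,u_{l_{i,k_i}})\ \wedge\ \bigwedge_{i=1}^m x_i=u_{j(i)}$, where $f_i\in\Sigma$ with $k_i=\mathrm{ar}(f_i)$ and $j:\{1,\dots,m\}\to\{1,\dots,n\}$, satisfying: (congruence closure) there are no two distinct $i\neq i'\le p$ with the same right-hand side $f(u_{l_1},\dots,u_{l_k})$; and (acyclicity) the directed graph on $\{u_1,\dots,u_n\}$ with an edge from $u_i$ to each argument $u_{l_{i,r}}$ of its defining equation ($i\le p$) has no cycle. -}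

module Defs where

open import Level using (0ℓ)
open import Data.Nat using (ℕ; _+_; _<_)
open import Data.Fin using (Fin; _↑ˡ_; _↑ʳ_)
open import Data.Vec using (Vec)
open import Data.Vec.Membership.Propositional using (_∈_)
open import Data.List using (List)
import Data.List.Membership.Propositional as LM
open import Data.Product using (Σ; ∃; ∃₂; _×_; _,_)
open import Relation.Binary.PropositionalEquality using (_≡_)
open import Relation.Binary.Core using (Rel)
open import Relation.Binary.Construct.Closure.Transitive using (TransClosure)
open import Relation.Nullary using (¬_)
open import Relation.Unary using (Pred)
open import Function.Definitions using (Injective)

record Signature : Set where
  field
    nsym     : ℕ
    ar       : Fin nsym → ℕ
    hasConst : ∃ λ f → ar f ≡ 0
    hasPos   : ∃ λ f → 0 < ar f
open Signature public

-- Ground terms = the term algebra (symbols interpreted freely).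
data Term (Sg : Signature) : Set where
  app : (f : Fin (nsym Sg)) → Vec (Term Sg) (ar Sg f) → Term Sg

-- A right-hand side f(u_{l_1},...,u_{l_k}) over internal variables Fin n.
RHS : Signature → ℕ → Set
RHS Sg n = Σ (Fin (nsym Sg)) (λ f → Vec (Fin n) (ar Sg f))

-- Dependency graph: edge from u_i (i ≤ p, i.e. (i ↑ˡ q)) to each argument.
-- Internal variables: Fin (p + q); u_1..u_p = (i ↑ˡ q), parameters = raise p k.
Edge : (Sg : Signature) (p q : ℕ) → (Fin p → RHS Sg (p + q)) → Rel (Fin (p + q)) 0ℓ
Edge Sg p q def v w = ∃ λ i → v ≡ (i ↑ˡ q) × w ∈ Data.Product.proj₂ (def i)

-- Base formula with m free variables, p non-parameter and q parameter
-- internal variables.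
record BaseFormula (Sg : Signature) (m p q : ℕ) : Set where
  field
    def        : Fin p → RHS Sg (p + q)      -- u_i = f_i(u_{l_i,1},...)
    out        : Fin m → Fin (p + q)          -- x_i = u_{j(i)}
    congClosed : Injective _≡_ _≡_ def
    acyclic    : ∀ v → ¬ TransClosure (Edge Sg p q def) v v
open BaseFormula public

evalRHS : ∀ {Sg n} → (Fin n → Term Sg) → RHS Sg n → Term Sg
evalRHS σu (f , args) = app f (Data.Vec.map σu args)

record Holds {Sg : Signature} {m p q : ℕ} (β : BaseFormula Sg m p q)
             (σx : Fin m → Term Sg) (σu : Fin (p + q) → Term Sg) : Set where
  field
    distinct : Injective _≡_ _≡_ σu
    defEqs   : ∀ i → σu ((i ↑ˡ q)) ≡ evalRHS σu (def β i)
    outEqs   : ∀ k → σx k ≡ σu (out β k)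

Infinite : ∀ {A : Set} → Pred A 0ℓ → Set
Infinite {A} S = ∀ (l : List A) → ∃ λ t → S t × ¬ (t LM.∈ l)

-- Pick the parameter values in the given infinite sets with heights above p + q + 2 and
-- pairwise more than p + q + 2 apart. As the defining equations are acyclic, iterating them
-- p + q times from a constant yields a solution. Following a highest argument downwards, a
-- defined variable has height at most p + q + 2 or exceeds the height of some parameter value
-- by between 1 and p + q + 1; either way it differs from every parameter height. Parameters
-- have distinct heights, and two defined variables with equal values have equal right-hand
-- sides by induction on the height, hence coincide by congruence closure.
module Submission where

open import Defs
open import Level using (0ℓ)
open import Data.Nat using (ℕ; zero; suc; _+_; _≤_; _<_; _⊔_; z≤n; s≤s)
open import Data.Nat.Properties
  using (≤-refl; ≤-trans; ≤-reflexive; ≤-pred; <⇒≱; ≰⇒>; m≤n⇒m≤1+n; n≤1+n; m≤m⊔n; m≤n⊔m; ⊔-sel;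
         m≤m+n; m≤n+m; +-mono-≤; m≢1+n+m; m≤n⇒m<n∨m≡n)
open import Data.Fin using (Fin; zero; suc; _↑ˡ_; _↑ʳ_; splitAt; toℕ)
open import Data.Fin.Properties using (splitAt-↑ˡ; splitAt-↑ʳ; splitAt⁻¹-↑ˡ; splitAt⁻¹-↑ʳ; pigeonhole; toℕ<n)
open import Data.Vec using (Vec; []; _∷_; map)
open import Data.Vec.Properties using (∷-injective)
open import Data.Vec.Relation.Unary.Any using (here; there)
open import Data.Vec.Relation.Unary.All as All using (All; []; _∷_)
open import Data.Vec.Relation.Unary.All.Properties using (map⁺)
open import Data.Vec.Membership.Propositional using (_∈_; find)
open import Data.Vec.Membership.Propositional.Properties using (∈-map⁺)
open import Data.List using (List; cartesianProductWith; concatMap; allFin)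
import Data.List.Membership.Propositional as List
import Data.List.Membership.Propositional.Properties as List
import Data.List.Relation.Unary.Any as ListAny
open import Data.Product using (Σ; ∃; ∃₂; _×_; _,_; proj₁; proj₂)
open import Data.Sum using (_⊎_; inj₁; inj₂; [_,_]′)
open import Data.Empty using (⊥-elim)
open import Function using (_∘_)
open import Function.Definitions using (Injective)
open import Relation.Binary.Core using (Rel)
open import Relation.Binary.PropositionalEquality using (_≡_; _≢_; refl; sym; trans; cong; cong₂; subst; module ≡-Reasoning)
open import Relation.Binary.Construct.Closure.Transitive using (TransClosure; [_]; _∷ʳ_)
open import Relation.Nullary using (¬_)
open import Relation.Unary using (Pred)

data Split (p q : ℕ) : Fin (p + q) → Set where
  inl : (i : Fin p) → Split p q (i ↑ˡ q)
  inr : (k : Fin q) → Split p q (p ↑ʳ k)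

split : ∀ p {q} (v : Fin (p + q)) → Split p q v
split p v with splitAt p v in eq
... | inj₁ i = subst (Split p _) (splitAt⁻¹-↑ˡ eq) (inl i)
... | inj₂ k = subst (Split p _) (splitAt⁻¹-↑ʳ eq) (inr k)

map-cong-All : ∀ {A B : Set} {f g : A → B} {n} {xs : Vec A n} →
               All (λ x → f x ≡ g x) xs → map f xs ≡ map g xs
map-cong-All []         = refl
map-cong-All (eq ∷ eqs) = cong₂ _∷_ eq (map-cong-All eqs)

map-injective-∈ : ∀ {A B : Set} (f : A → B) {n} (xs ys : Vec A n) → map f xs ≡ map f ys →
                  (∀ {x} → x ∈ xs → ∀ {y} → f x ≡ f y → x ≡ y) → xs ≡ ys
map-injective-∈ f []       []       _  _   = refl
map-injective-∈ f (x ∷ xs) (y ∷ ys) eq inj with eq₁ , eq₂ ← ∷-injective eq =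
  cong₂ _∷_ (inj (here refl) eq₁) (map-injective-∈ f xs ys eq₂ (inj ∘ there))

module AcyclicWalk {n : ℕ} (_⟶_ : Rel (Fin n) 0ℓ) (acyclic : ∀ v → ¬ TransClosure _⟶_ v v) where

  Walk : ℕ → Fin n → Set
  Walk s v = Σ (ℕ → Fin n) λ c → c 0 ≡ v × (∀ k → k < s → c k ⟶ c (suc k))

  walk-cons : ∀ {s v w} → v ⟶ w → Walk s w → Walk (suc s) v
  walk-cons {v = v} {w} v⟶w (c , c₀ , steps) = c′ , refl , steps′
    where
      c′ : ℕ → Fin n
      c′ zero    = v
      c′ (suc k) = c k

      steps′ : ∀ k → k < suc _ → c′ k ⟶ c′ (suc k)
      steps′ zero    _       = subst (v ⟶_) (sym c₀) v⟶w
      steps′ (suc k) (s≤s k<s) = steps k k<s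

  walk-segment : ∀ {s v} ((c , _ , _) : Walk s v) {a b} → a < b → b ≤ s → TransClosure _⟶_ (c a) (c b)
  walk-segment (c , _ , steps) {a} {suc b} a<b b<s with m≤n⇒m<n∨m≡n (≤-pred a<b)
  ... | inj₂ refl = [ steps a b<s ]
  ... | inj₁ a<b′ = walk-segment (c , refl , steps) a<b′ (≤-trans (n≤1+n b) b<s) ∷ʳ steps b b<s

  no-long-walk : ∀ {s v} → n ≤ s → ¬ Walk s v
  no-long-walk n≤s walk@(c , _ , _)
    with i , j , i<j , cᵢ≡cⱼ ← pigeonhole (s≤s n≤s) (c ∘ toℕ) =
    acyclic (c (toℕ i)) (subst (TransClosure _⟶_ (c (toℕ i))) (sym cᵢ≡cⱼ)
      (walk-segment walk i<j (≤-pred (toℕ<n j))))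

Separated : ∀ {q} → ℕ → (Fin q → ℕ) → Set
Separated g h = ∀ {k j d} → d ≤ g → h j ≡ d + h k → k ≡ j

upper-bound : ∀ {q} (h : Fin q → ℕ) → ∃ λ b → ∀ k → h k ≤ b
upper-bound {zero}  h = 0 , λ ()
upper-bound {suc q} h with b , h≤b ← upper-bound (h ∘ suc) = h zero ⊔ b , bound
  where
    bound : ∀ k → h k ≤ h zero ⊔ b
    bound zero    = m≤m⊔n _ _
    bound (suc k) = ≤-trans (h≤b k) (m≤n⊔m _ _)

module TermHeight (Sg : Signature) where

  mutual
    height : Term Sg → ℕ
    height (app f ts) = suc (hmax ts)

    hmax : ∀ {n} → Vec (Term Sg) n → ℕ
    hmax []       = 0
    hmax (t ∷ ts) = height t ⊔ hmax ts

  height-positive : ∀ t → 0 < height t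
  height-positive (app _ _) = s≤s z≤n

  ∈⇒height≤hmax : ∀ {n x} {xs : Vec (Term Sg) n} → x ∈ xs → height x ≤ hmax xs
  ∈⇒height≤hmax (here refl) = m≤m⊔n _ _
  ∈⇒height≤hmax (there x∈xs) = ≤-trans (∈⇒height≤hmax x∈xs) (m≤n⊔m _ _)

  hmax-attained : ∀ {n} (xs : Vec (Term Sg) n) → hmax xs ≡ 0 ⊎ ∃ λ x → x ∈ xs × hmax xs ≡ height x
  hmax-attained []       = inj₁ refl
  hmax-attained (t ∷ ts) with ⊔-sel (height t) (hmax ts)
  ... | inj₁ eq = inj₂ (t , here refl , eq)
  ... | inj₂ eq with hmax-attained ts
  ...   | inj₁ eq₀              = inj₁ (trans eq eq₀)
  ...   | inj₂ (x , x∈ts , eq′) = inj₂ (x , there x∈ts , trans eq eq′)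

  leaf : Term Sg
  leaf = app (proj₁ (hasConst Sg)) (subst (Vec (Term Sg)) (sym (proj₂ (hasConst Sg))) [])

  height-leaf : height leaf ≡ 1
  height-leaf = cong suc (hmax-nil (proj₂ (hasConst Sg)))
    where
      hmax-nil : ∀ {n} (n≡0 : n ≡ 0) → hmax (subst (Vec (Term Sg)) (sym n≡0) []) ≡ 0
      hmax-nil refl = refl

  root : Term Sg → Fin (nsym Sg)
  root (app f _) = f

  app-injective : ∀ {f} {xs ys : Vec (Term Sg) (ar Sg f)} → app f xs ≡ app f ys → xs ≡ ys
  app-injective refl = refl

  evalRHS-injective : ∀ {n} (σ : Fin n → Term Sg) (r r′ : RHS Sg n) → evalRHS σ r ≡ evalRHS σ r′ →
                      (∀ {x} → x ∈ proj₂ r → ∀ {y} → σ x ≡ σ y → x ≡ y) → r ≡ r′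
  evalRHS-injective σ (f , xs) (g , ys) eq inj with refl ← cong root eq =
    cong (f ,_) (map-injective-∈ σ xs ys (app-injective eq) inj)

  vectorsOver : ∀ {A : Set} n → List A → List (Vec A n)
  vectorsOver zero    _ = Data.List.[ [] ]
  vectorsOver (suc n) l = cartesianProductWith _∷_ l (vectorsOver n l)

  termsOfHeight≤ : ℕ → List (Term Sg)
  termsOfHeight≤ zero    = Data.List.[]
  termsOfHeight≤ (suc h) =
    concatMap (λ f → Data.List.map (app f) (vectorsOver (ar Sg f) (termsOfHeight≤ h))) (allFin (nsym Sg))

  mutual
    ∈-termsOfHeight≤ : ∀ h t → height t ≤ h → t List.∈ termsOfHeight≤ h
    ∈-termsOfHeight≤ (suc h) (app f ts) (s≤s ts≤h) =
      List.∈-concatMap⁺ (λ f → Data.List.map (app f) (vectorsOver (ar Sg f) (termsOfHeight≤ h)))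
        (ListAny.map (λ { refl → List.∈-map⁺ (app f) (∈-vectorsOver h ts ts≤h) }) (List.∈-allFin f))

    ∈-vectorsOver : ∀ {n} h (ts : Vec (Term Sg) n) → hmax ts ≤ h → ts List.∈ vectorsOver n (termsOfHeight≤ h)
    ∈-vectorsOver h []       _     = ListAny.here refl
    ∈-vectorsOver h (t ∷ ts) ts≤h = List.∈-cartesianProductWith⁺ _∷_
      (∈-termsOfHeight≤ h t (≤-trans (m≤m⊔n _ _) ts≤h)) (∈-vectorsOver h ts (≤-trans (m≤n⊔m _ _) ts≤h))

  infinite⇒unbounded-height : ∀ {S : Pred (Term Sg) 0ℓ} → Infinite S → ∀ b → ∃ λ t → S t × b < height t
  infinite⇒unbounded-height infinite b with t , t∈S , t∉ ← infinite (termsOfHeight≤ b) =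
    t , t∈S , ≰⇒> (t∉ ∘ ∈-termsOfHeight≤ b t)

  choose-separated : ∀ g {q} (S : Fin q → Pred (Term Sg) 0ℓ) → (∀ k → Infinite (S k)) →
                     ∃ λ t → (∀ k → S k (t k)) × (∀ k → g < height (t k)) × Separated g (height ∘ t)
  choose-separated g {zero}  S infinite = (λ ()) , (λ ()) , (λ ()) , λ { {()} }
  choose-separated g {suc q} S infinite
    with t , t∈S , tall , separated ← choose-separated g (S ∘ suc) (infinite ∘ suc)
    with b , t≤b ← upper-bound (height ∘ t)
    with t₀ , t₀∈S , t₀-tall ← infinite⇒unbounded-height (infinite zero) (g + b)
    = t′ , t′∈S , tall′ , separated′
    where
      t′ : Fin (suc q) → Term Sg
      t′ zero    = t₀
      t′ (suc k) = t k

      t′∈S : ∀ k → S k (t′ k)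
      t′∈S zero    = t₀∈S
      t′∈S (suc k) = t∈S k

      tall′ : ∀ k → g < height (t′ k)
      tall′ zero    = ≤-trans (s≤s (m≤m+n g b)) t₀-tall
      tall′ (suc k) = tall k

      above : ∀ {k d} → d ≤ g → d + height (t k) < height t₀
      above {k} {d} d≤g = ≤-trans (s≤s (+-mono-≤ d≤g (t≤b k))) t₀-tall

      separated′ : Separated g (height ∘ t′)
      separated′ {zero}  {zero}  _   _  = refl
      separated′ {zero}  {suc j} {d} _ eq =
        ⊥-elim (<⇒≱ (above {j} z≤n) (≤-trans (m≤n+m _ d) (≤-reflexive (sym eq))))
      separated′ {suc k} {zero}  d≤g eq = ⊥-elim (<⇒≱ (above {k} d≤g) (≤-reflexive eq))
      separated′ {suc k} {suc j} d≤g eq = cong suc (separated d≤g eq)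

module Solution {Sg : Signature} {m p q : ℕ} (β : BaseFormula Sg m p q) (t : Fin q → Term Sg) where
  open TermHeight Sg
  open AcyclicWalk (Edge Sg p q (def β)) (acyclic β)

  N : ℕ
  N = p + q

  step : (Fin N → Term Sg) → Fin N → Term Sg
  step σ v = [ (λ i → evalRHS σ (def β i)) , t ]′ (splitAt p v)

  step-defined : ∀ σ i → step σ (i ↑ˡ q) ≡ evalRHS σ (def β i)
  step-defined σ i = cong [ (λ i → evalRHS σ (def β i)) , t ]′ (splitAt-↑ˡ p i q)

  step-parameter : ∀ σ k → step σ (p ↑ʳ k) ≡ t k
  step-parameter σ k = cong [ (λ i → evalRHS σ (def β i)) , t ]′ (splitAt-↑ʳ p q k)

  approx : ℕ → Fin N → Term Sg
  approx zero    _ = leaf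
  approx (suc s) = step (approx s)

  approx-stable-or-walk : ∀ s v → approx s v ≡ approx (suc s) v ⊎ Walk s v
  approx-stable-or-walk zero    v = inj₂ ((λ _ → v) , refl , λ _ ())
  approx-stable-or-walk (suc s) v with split p v
  ... | inr k = inj₁ (trans (step-parameter (approx s) k) (sym (step-parameter (approx (suc s)) k)))
  ... | inl i with All.decide (approx-stable-or-walk s) (proj₂ (def β i))
  ...   | inj₁ stable = inj₁ (begin
          approx (suc s) (i ↑ˡ q)               ≡⟨ step-defined (approx s) i ⟩
          evalRHS (approx s) (def β i)          ≡⟨ cong (app (proj₁ (def β i))) (map-cong-All stable) ⟩
          evalRHS (approx (suc s)) (def β i)    ≡⟨ sym (step-defined (approx (suc s)) i) ⟩
          approx (suc (suc s)) (i ↑ˡ q)         ∎)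
    where open ≡-Reasoning
  ...   | inj₂ unstable with w , w∈ , walk ← find unstable = inj₂ (walk-cons (i , refl , w∈) walk)

  solution : Fin N → Term Sg
  solution = approx N

  solution-stable : ∀ v → solution v ≡ approx (suc N) v
  solution-stable v with approx-stable-or-walk N v
  ... | inj₁ stable = stable
  ... | inj₂ walk   = ⊥-elim (no-long-walk ≤-refl walk)

  solution-defined : ∀ i → solution (i ↑ˡ q) ≡ evalRHS solution (def β i)
  solution-defined i = trans (solution-stable (i ↑ˡ q)) (step-defined solution i)

  solution-parameter : ∀ k → solution (p ↑ʳ k) ≡ t k
  solution-parameter k = trans (solution-stable (p ↑ʳ k)) (step-parameter solution k)

  Banded : ℕ → Term Sg → Set
  Banded s x = height x ≤ suc s ⊎ ∃₂ λ k d → d ≤ s × height x ≡ d + height (t k)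

  StrictlyBanded : ℕ → Term Sg → Set
  StrictlyBanded s x = height x ≤ suc (suc s) ⊎ ∃₂ λ k d → d ≤ s × height x ≡ suc d + height (t k)

  app-strictlyBanded : ∀ {s f} (xs : Vec (Term Sg) (ar Sg f)) → All (Banded s) xs → StrictlyBanded s (app f xs)
  app-strictlyBanded xs banded with hmax-attained xs
  ... | inj₁ eq₀ = inj₁ (s≤s (≤-trans (≤-reflexive eq₀) z≤n))
  ... | inj₂ (x , x∈xs , eq) with All.lookup banded x∈xs
  ...   | inj₁ low                  = inj₁ (s≤s (≤-trans (≤-reflexive eq) low))
  ...   | inj₂ (k , d , d≤s , eq′) = inj₂ (k , d , d≤s , cong suc (trans eq eq′))

  strictlyBanded⇒banded : ∀ {s x} → StrictlyBanded s x → Banded (suc s) x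
  strictlyBanded⇒banded (inj₁ low)                 = inj₁ low
  strictlyBanded⇒banded (inj₂ (k , d , d≤s , eq)) = inj₂ (k , suc d , s≤s d≤s , eq)

  evalRHS-strictlyBanded : ∀ {s} σ (r : RHS Sg N) → (∀ v → Banded s (σ v)) → StrictlyBanded s (evalRHS σ r)
  evalRHS-strictlyBanded σ (f , vs) banded = app-strictlyBanded (map σ vs) (map⁺ (All.universal banded vs))

  approx-banded : ∀ s v → Banded s (approx s v)
  approx-banded zero    v = inj₁ (≤-reflexive height-leaf)
  approx-banded (suc s) v with split p v
  ... | inr k = inj₂ (k , 0 , z≤n , cong height (step-parameter (approx s) k))
  ... | inl i = strictlyBanded⇒banded (subst (StrictlyBanded s) (sym (step-defined (approx s) i))
                  (evalRHS-strictlyBanded (approx s) (def β i) (approx-banded s)))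

  solution-defined-strictlyBanded : ∀ i → StrictlyBanded N (solution (i ↑ˡ q))
  solution-defined-strictlyBanded i = subst (StrictlyBanded N) (sym (solution-defined i))
    (evalRHS-strictlyBanded solution (def β i) (approx-banded N))

  module _ (tall : ∀ k → 2 + N < height (t k)) (separated : Separated (2 + N) (height ∘ t)) where

    defined-height≢parameter-height : ∀ i k → height (solution (i ↑ˡ q)) ≢ height (t k)
    defined-height≢parameter-height i k eq with solution-defined-strictlyBanded i
    ... | inj₁ low = <⇒≱ (tall k) (subst (_≤ 2 + N) eq low)
    ... | inj₂ (k′ , d , d≤N , eq′) with refl ← separated (s≤s (m≤n⇒m≤1+n d≤N)) (trans (sym eq) eq′) =
      m≢1+n+m (height (t k)) (trans (sym eq) eq′)

    defined≢parameter : ∀ i k → solution (i ↑ˡ q) ≢ solution (p ↑ʳ k)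
    defined≢parameter i k eq =
      defined-height≢parameter-height i k (cong height (trans eq (solution-parameter k)))

    mutual
      injective-below : ∀ b {v w} → height (solution v) ≤ b → solution v ≡ solution w → v ≡ w
      injective-below b {v} {w} v≤b eq with split p v | split p w
      ... | inl i | inl j  = cong (_↑ˡ q) (defined-injective-below b i j v≤b eq)
      ... | inl i | inr k  = ⊥-elim (defined≢parameter i k eq)
      ... | inr k | inl j  = ⊥-elim (defined≢parameter j k (sym eq))
      ... | inr k | inr k′ = cong (p ↑ʳ_) (separated z≤n
            (cong height (trans (sym (solution-parameter k′)) (trans (sym eq) (solution-parameter k)))))

      defined-injective-below : ∀ b i j → height (solution (i ↑ˡ q)) ≤ b →
                                solution (i ↑ˡ q) ≡ solution (j ↑ˡ q) → i ≡ j
      defined-injective-below zero    i j i≤0 _  = ⊥-elim (<⇒≱ (height-positive _) i≤0)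
      defined-injective-below (suc b) i j i≤b eq =
        congClosed β (evalRHS-injective solution (def β i) (def β j)
          (trans (sym (solution-defined i)) (trans eq (solution-defined j)))
          λ v∈ → injective-below b (argument≤b v∈))
        where
          argument≤b : ∀ {v} → v ∈ proj₂ (def β i) → height (solution v) ≤ b
          argument≤b v∈ = ≤-pred (≤-trans (s≤s (∈⇒height≤hmax (∈-map⁺ solution v∈)))
                            (subst (_≤ suc b) (cong height (solution-defined i)) i≤b))

    solution-injective : Injective _≡_ _≡_ solution
    solution-injective = injective-below _ ≤-refl

mainTheorem6 : ∀ {Sg : Signature} {m p q : ℕ} (β : BaseFormula Sg m p q)
    (S : Fin q → Pred (Term Sg) 0ℓ) → (∀ k → Infinite (S k)) →
    ∃₂ λ (σx : Fin m → Term Sg) (σu : Fin (p Data.Nat.+ q) → Term Sg) →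
      Holds β σx σu × (∀ k → S k (σu (p ↑ʳ k)))
mainTheorem6 {Sg} {m} {p} {q} β S infinite
  with t , t∈S , tall , separated ← TermHeight.choose-separated Sg (2 + (p + q)) S infinite =
  (λ k → solution (out β k)) , solution ,
  record { distinct = solution-injective tall separated ; defEqs = solution-defined ; outEqs = λ _ → refl } ,
  λ k → subst (S k) (sym (solution-parameter k)) (t∈S k)
  where open Solution β t
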